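{- Consider the online maximum $k$-interval coverage problem in the Arbitrary-Length (AL) setting, with quota $k\ge 2$ (both for the case where the number of released sub-intervals is known in advance and for the case where it is not). Then no online deterministic algorithm achieves a bounded competitive ratio; that is, for every deterministic online algorithm $\mathrm{ALG}$ and every real number $\rho\ge 1$, there is an instance $\mathbb{V}$ with $\mathrm{OPT}(\mathbb{V})>\rho\,\mathrm{ALG}(\mathbb{V})$.
   Context: Online maximum $k$-interval coverage problem: there is a target interval $[0,a]$ (part of the instance). Sub-intervals $V_1,V_2,\dots$ with $V_i=[o_i,d_i]\subseteq[0,a]$ are released one at a time in an adversarial order. On the release of $V_i$ the algorithm must immediately and irrevocably accept or reject it (no preemption), without knowledge of future sub-intervals. At most $k$ sub-intervals may be accepted. For a set $U$ of sub-intervals let $Len(U)=|\bigcup_{V\in U}V|$ (Lebesgue measure of the union). The goal is to maximize $Len(U)$ for the accepted set $U$. $\mathrm{ALG}(\mathbb{V})$ denotes the value obtained by algorithm ALG on instance $\mathbb{V}$, and $\mathrm{OPT}(\mathbb{V})$ the maximum of $Len(U)$ over all $U\subseteq\mathbb{V}$ with $|U|\le k$ (offline optimum). ALG is $\rho$-competitive if $\mathrm{OPT}(\mathbb{V})\le\rho\,\mathrm{ALG}(\mathbb{V})$ for every instance $\mathbb{V}$. In the Arbitrary-Length (AL) setting, the length $d_i-o_i$ of each released sub-interval may be any value in $[0,a]$.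
   Formalization: The ratio ρ ranges over the rationals rather than every real number, and each deterministic online algorithm acts only on rational target lengths $a$ and rational sub-interval endpoints. -}

module Defs where

open import Data.Bool using (Bool; true; false)
open import Data.Nat using (ℕ; zero; suc)
open import Data.List using (List; []; _∷_; _++_; [_]; length)
open import Data.Vec using (Vec; []; _∷_; fromList)
import Data.Vec as Vec
open import Data.Rational using (ℚ; 0ℚ; _+_; _-_; _*_; _⊔_; _⊓_; _≤_; _<_)
open import Data.Product using (_×_)

record Interval : Set where
  constructor [_,_]
  field
    lo hi : ℚ
open Interval public

-- Length of an interval (only used for lo ≤ hi, or for clipped intervals
-- which are normalised so that lo ≤ hi).
∣_∣ᵢ : Interval → ℚ
∣ I ∣ᵢ = hi I - lo I

-- clip I J = J ∩ I, with an empty intersection represented by a degenerate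
-- interval [m , m] of length 0 (assuming lo ≤ hi for I and J).
clip : Interval → Interval → Interval
clip I J = [ m , m ⊔ (hi I ⊓ hi J) ]
  where m = lo I ⊔ lo J

-- Lebesgue measure of a finite union of intervals, by inclusion–exclusion:
-- |I ∪ ⋃U| = |I| + |⋃U| - |⋃_{J∈U} (I ∩ J)|.
LenV : ∀ n → Vec Interval n → ℚ
LenV zero [] = 0ℚ
LenV (suc n) (I ∷ Us) = (∣ I ∣ᵢ + LenV n Us) - LenV n (Vec.map (clip I) Us)

Len : List Interval → ℚ
Len U = LenV (length U) (fromList U)

ValidIn : ℚ → Interval → Set
ValidIn a I = (0ℚ ≤ lo I) × (lo I ≤ hi I) × (hi I ≤ a)

-- Deterministic online algorithm, number of sub-intervals KNOWN in advance:
-- decides acceptance of the current sub-interval from the target length a,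
-- the total number n of sub-intervals, the history of released
-- sub-intervals (in release order), and the current sub-interval.
-- (Its own past decisions are determined by the history, as it is deterministic.)
KnownAlg : Set
KnownAlg = ℚ → ℕ → List Interval → Interval → Bool

UnknownAlg : Set
UnknownAlg = ℚ → List Interval → Interval → Bool

run : (List Interval → Interval → Bool) → ℕ → List Interval → List Interval → List Interval
run f q hist [] = []
run f zero hist (v ∷ vs) = []
run f (suc q) hist (v ∷ vs) with f hist v
... | true  = v ∷ run f q (hist ++ [ v ]) vs
... | false = run f (suc q) (hist ++ [ v ]) vs

ALGknown : ℕ → KnownAlg → ℚ → List Interval → ℚ
ALGknown k alg a V = Len (run (alg a (length V)) k [] V)

ALGunknown : ℕ → UnknownAlg → ℚ → List Interval → ℚ
ALGunknown k alg a V = Len (run (alg a) k [] V)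

-- The adversary releases the nested intervals [0,c], [0,c²], [0,c³], … with c = ρ + 1
-- until the algorithm rejects one or has used up its quota, and then pads the
-- instance with zero-length intervals, so that it always has k + 1 sub-intervals
-- whatever the algorithm does (this defeats knowing their number in advance).
-- Nested intervals cover exactly their largest member, so if [0,cⁱ⁺¹] is the first
-- interval not accepted, the algorithm covers at most cⁱ while the single interval
-- [0,cⁱ⁺¹] covers cⁱ⁺¹ > ρ cⁱ.
module Submission where

open import Defs
open import Data.Nat using (ℕ; _≤_)
open import Data.List using (List; length)
open import Data.List.Relation.Unary.All using (All)
open import Data.List.Relation.Binary.Sublist.Propositional using (_⊆_)
open import Data.Rational using (ℚ; 1ℚ; _*_; _<_)
import Data.Rational as ℚ
open import Data.Product using (_×_; ∃-syntax)

open import Data.Bool using (Bool; true; false)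
open import Data.Nat using (zero; suc; z≤n; s≤s)
import Data.Nat as ℕ
import Data.Nat.Properties as ℕₚ
open import Data.List using ([]; _∷_; _++_; replicate)
open import Data.List.Properties using (length-replicate)
open import Data.List.Relation.Unary.All using ([]; _∷_)
import Data.List.Relation.Unary.All as Listᴬ
open import Data.List.Relation.Unary.All.Properties using (replicate⁺)
open import Data.List.Relation.Unary.Any using (here; there)
open import Data.List.Membership.Propositional using (_∈_)
open import Data.List.Relation.Binary.Sublist.Propositional using (from∈)
open import Data.Vec using (Vec; fromList)
import Data.Vec as Vec
import Data.Vec.Relation.Unary.All as Vecᴬ
open import Data.Vec.Relation.Unary.All.Properties using (fromList⁺; map⁺)
open import Data.Rational using (0ℚ; _+_; _-_; _⊔_; _⊓_; positive; nonNegative)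
open import Data.Rational.Properties
open import Data.Rational.Solver using (module +-*-Solver)
open import Data.Product using (_,_; proj₁)
open import Data.Sum using (inj₁; inj₂)
open import Relation.Binary.PropositionalEquality
  using (_≡_; refl; sym; trans; cong; cong₂; subst; subst₂; module ≡-Reasoning)

Anchored : Interval → Set
Anchored I = lo I ≡ 0ℚ × 0ℚ ℚ.≤ hi I

AnchoredWithin : ℚ → Interval → Set
AnchoredWithin b I = Anchored I × hi I ℚ.≤ b

maxHi : ∀ {n} → Vec Interval n → ℚ
maxHi Vec.[]       = 0ℚ
maxHi (I Vec.∷ Us) = hi I ⊔ maxHi Us

maxHi-≤ : ∀ {b n} {Us : Vec Interval n} → 0ℚ ℚ.≤ b →
          Vecᴬ.All (AnchoredWithin b) Us → maxHi Us ℚ.≤ b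
maxHi-≤ 0≤b Vecᴬ.[]                 = 0≤b
maxHi-≤ 0≤b ((_ , hi≤b) Vecᴬ.∷ Us≤b) = ⊔-lub hi≤b (maxHi-≤ 0≤b Us≤b)

clip-anchored : ∀ {I J} → Anchored I → Anchored J → Anchored (clip I J)
clip-anchored {[ _ , h ]} {[ _ , h′ ]} (refl , _) (refl , _) = refl , p≤p⊔q 0ℚ (h ⊓ h′)

maxHi-clip : ∀ {n} h (Us : Vec Interval n) → 0ℚ ℚ.≤ h → Vecᴬ.All Anchored Us →
             maxHi (Vec.map (clip [ 0ℚ , h ]) Us) ≡ h ⊓ maxHi Us
maxHi-clip h Vec.[] 0≤h Vecᴬ.[] = sym (p≥q⇒p⊓q≡q 0≤h)
maxHi-clip h ([ _ , h′ ] Vec.∷ Us) 0≤h ((refl , 0≤h′) Vecᴬ.∷ anchored) = begin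
  0ℚ ⊔ (h ⊓ h′) ⊔ maxHi (Vec.map (clip [ 0ℚ , h ]) Us)
    ≡⟨ cong₂ _⊔_ (p≤q⇒p⊔q≡q (⊓-glb 0≤h 0≤h′)) (maxHi-clip h Us 0≤h anchored) ⟩
  (h ⊓ h′) ⊔ (h ⊓ maxHi Us)
    ≡⟨ ⊓-distribˡ-⊔ h h′ (maxHi Us) ⟨
  h ⊓ (h′ ⊔ maxHi Us) ∎
  where open ≡-Reasoning

p-0+q-p⊓q≡p⊔q : ∀ p q → (p - 0ℚ + q) - p ⊓ q ≡ p ⊔ q
p-0+q-p⊓q≡p⊔q p q with ≤-total p q
... | inj₁ p≤q rewrite p≤q⇒p⊓q≡p p≤q | p≤q⇒p⊔q≡q p≤q =
  solve 2 (λ p q → (p :- con 0ℚ :+ q) :- p := q) refl p q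
  where open +-*-Solver
... | inj₂ q≤p rewrite p≥q⇒p⊓q≡q q≤p | p≥q⇒p⊔q≡p q≤p =
  solve 2 (λ p q → (p :- con 0ℚ :+ q) :- q := p) refl p q
  where open +-*-Solver

-- Inclusion–exclusion in LenV collapses: clipping by [0,h] turns every anchored
-- interval [0,h′] into [0, h ⊓ h′], and h + m − h ⊓ m = h ⊔ m.
LenV-anchored : ∀ n (Us : Vec Interval n) → Vecᴬ.All Anchored Us → LenV n Us ≡ maxHi Us
LenV-anchored zero Vec.[] Vecᴬ.[] = refl
LenV-anchored (suc n) ([ _ , h ] Vec.∷ Us) ((refl , 0≤h) Vecᴬ.∷ anchored) = begin
  (h - 0ℚ + LenV n Us) - LenV n (Vec.map (clip [ 0ℚ , h ]) Us)
    ≡⟨ cong₂ (λ x y → (h - 0ℚ + x) - y) (LenV-anchored n Us anchored) clipped ⟩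
  (h - 0ℚ + maxHi Us) - h ⊓ maxHi Us
    ≡⟨ p-0+q-p⊓q≡p⊔q h (maxHi Us) ⟩
  h ⊔ maxHi Us ∎
  where
  open ≡-Reasoning
  clipped : LenV n (Vec.map (clip [ 0ℚ , h ]) Us) ≡ h ⊓ maxHi Us
  clipped = trans
    (LenV-anchored n _ (map⁺ (Vecᴬ.map (clip-anchored (refl , 0≤h)) anchored)))
    (maxHi-clip h Us 0≤h anchored)

Len-anchored-≤ : ∀ {b} (U : List Interval) → 0ℚ ℚ.≤ b → All (AnchoredWithin b) U → Len U ℚ.≤ b
Len-anchored-≤ U 0≤b U≤b = subst (ℚ._≤ _) (sym Len≡maxHi) (maxHi-≤ 0≤b (fromList⁺ U≤b))
  where
  Len≡maxHi : Len U ≡ maxHi (fromList U)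
  Len≡maxHi = LenV-anchored (length U) (fromList U) (fromList⁺ (Listᴬ.map proj₁ U≤b))

Len-[0,h] : ∀ {h} → 0ℚ ℚ.≤ h → Len ([ 0ℚ , h ] ∷ []) ≡ h
Len-[0,h] 0≤h = trans (LenV-anchored 1 _ ((refl , 0≤h) Vecᴬ.∷ Vecᴬ.[])) (p≥q⇒p⊔q≡p 0≤h)

AnchoredWithin⇒ValidIn : ∀ {a I} → AnchoredWithin a I → ValidIn a I
AnchoredWithin⇒ValidIn {I = [ _ , _ ]} ((refl , 0≤hi) , hi≤a) = ≤-refl , 0≤hi , hi≤a

run-All : ∀ {P : Interval → Set} f q hist {vs : List Interval} → All P vs → All P (run f q hist vs)
run-All f q       hist {[]}     []         = []
run-All f zero    hist {_ ∷ _}  _          = []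
run-All f (suc q) hist {v ∷ vs} (pv ∷ pvs) with f hist v
... | true  = pv ∷ run-All f q _ pvs
... | false = run-All f (suc q) _ pvs

module Adversary (ρ : ℚ) (1≤ρ : 1ℚ ℚ.≤ ρ) where

  c : ℚ
  c = ρ + 1ℚ

  infix 8 c^_
  c^_ : ℕ → ℚ
  c^ zero  = 1ℚ
  c^ suc n = c * c^ n

  0≤ρ : 0ℚ ℚ.≤ ρ
  0≤ρ = ≤-trans (nonNegative⁻¹ 1ℚ) 1≤ρ

  1≤c : 1ℚ ℚ.≤ c
  1≤c = ≤-trans 1≤ρ (subst (ℚ._≤ c) (+-identityʳ ρ) (+-monoʳ-≤ ρ (nonNegative⁻¹ 1ℚ)))

  0<c^ : ∀ n → 0ℚ < c^ n
  0<c^ zero    = positive⁻¹ 1ℚ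
  0<c^ (suc n) = positive⁻¹ (c * c^ n)
    {{pos*pos⇒pos c {{positive (<-≤-trans (positive⁻¹ 1ℚ) 1≤c)}} (c^ n) {{positive (0<c^ n)}}}}

  0≤c^ : ∀ n → 0ℚ ℚ.≤ c^ n
  0≤c^ n = <⇒≤ (0<c^ n)

  c^n≤c^1+n : ∀ n → c^ n ℚ.≤ c^ suc n
  c^n≤c^1+n n = subst (ℚ._≤ c * c^ n) (*-identityˡ (c^ n))
                  (*-monoʳ-≤-nonNeg (c^ n) {{nonNegative (0≤c^ n)}} 1≤c)

  c^-monotone : ∀ {m n} → m ≤ n → c^ m ℚ.≤ c^ n
  c^-monotone {n = zero}  z≤n = ≤-refl
  c^-monotone {n = suc n} m≤1+n with ℕₚ.m≤n⇒m<n∨m≡n m≤1+n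
  ... | inj₁ (s≤s m≤n) = ≤-trans (c^-monotone m≤n) (c^n≤c^1+n n)
  ... | inj₂ refl      = ≤-refl

  ρc^n<c^1+n : ∀ n → ρ * c^ n < c^ suc n
  ρc^n<c^1+n n = subst₂ _<_ (+-identityʳ (ρ * c^ n)) (ρx+x≡[ρ+1]x ρ (c^ n))
                   (+-monoʳ-< (ρ * c^ n) (0<c^ n))
    where
    open +-*-Solver
    ρx+x≡[ρ+1]x : ∀ r x → r * x + x ≡ (r + 1ℚ) * x
    ρx+x≡[ρ+1]x = solve 2 (λ r x → r :* x :+ x := (r :+ con 1ℚ) :* x) refl

  nested : ℕ → Interval
  nested n = [ 0ℚ , c^ n ]

  -- The index j records that everything accepted so far lies in [0,cʲ].
  adversary : (List Interval → Interval → Bool) → ℕ → List Interval → ℕ → List Interval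
  adversary f zero    hist j = nested (suc j) ∷ []
  adversary f (suc q) hist j with f hist (nested (suc j))
  ... | true  = nested (suc j) ∷ adversary f q (hist ++ (nested (suc j) ∷ [])) (suc j)
  ... | false = nested (suc j) ∷ replicate (suc q) [ 0ℚ , 0ℚ ]

  length-adversary : ∀ f q hist j → length (adversary f q hist j) ≡ suc q
  length-adversary f zero    hist j = refl
  length-adversary f (suc q) hist j with f hist (nested (suc j))
  ... | true  = cong suc (length-adversary f q _ (suc j))
  ... | false = cong suc (length-replicate (suc q))

  nested-within : ∀ {n B} → n ≤ B → AnchoredWithin (c^ B) (nested n)
  nested-within {n} n≤B = (refl , 0≤c^ n) , c^-monotone n≤B

  zeros-within : ∀ b m → 0ℚ ℚ.≤ b → All (AnchoredWithin b) (replicate m [ 0ℚ , 0ℚ ])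
  zeros-within b m 0≤b = replicate⁺ m ((refl , ≤-refl) , 0≤b)

  adversary-within : ∀ f q hist j {B} → q ℕ.+ suc j ≤ B →
                     All (AnchoredWithin (c^ B)) (adversary f q hist j)
  adversary-within f zero    hist j q+1+j≤B = nested-within q+1+j≤B ∷ []
  adversary-within f (suc q) hist j {B} q+1+j≤B with f hist (nested (suc j))
  ... | true  = nested-within (ℕₚ.≤-trans (ℕₚ.m≤n+m _ (suc q)) q+1+j≤B)
              ∷ adversary-within f q _ (suc j) (subst (_≤ B) (sym (ℕₚ.+-suc q (suc j))) q+1+j≤B)
  ... | false = nested-within (ℕₚ.≤-trans (ℕₚ.m≤n+m _ (suc q)) q+1+j≤B)
              ∷ zeros-within (c^ B) (suc q) (0≤c^ B)

  adversary-outgrows : ∀ f q hist j →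
    ∃[ i ] (j ≤ i × nested (suc i) ∈ adversary f q hist j
            × All (AnchoredWithin (c^ i)) (run f q hist (adversary f q hist j)))
  adversary-outgrows f zero hist j = j , ℕₚ.≤-refl , here refl , []
  adversary-outgrows f (suc q) hist j with f hist (nested (suc j)) in accepted
  ... | true rewrite accepted with adversary-outgrows f q (hist ++ (nested (suc j) ∷ [])) (suc j)
  ... | i , 1+j≤i , released , accepted≤ =
    i , ℕₚ.≤-trans (ℕₚ.n≤1+n j) 1+j≤i , there released , nested-within 1+j≤i ∷ accepted≤
  adversary-outgrows f (suc q) hist j | false rewrite accepted =
    j , ℕₚ.≤-refl , here refl , run-All f (suc q) _ (zeros-within (c^ j) (suc q) (0≤c^ j))

  adversary-wins : ∀ k → 1 ≤ k → (f : List Interval → Interval → Bool) →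
    All (ValidIn (c^ suc k)) (adversary f k [] 0) ×
    ∃[ U ] (U ⊆ adversary f k [] 0 × length U ≤ k
            × ρ * Len (run f k [] (adversary f k [] 0)) < Len U)
  adversary-wins k 1≤k f with adversary-outgrows f k [] 0
  ... | i , _ , released , accepted≤ =
    Listᴬ.map AnchoredWithin⇒ValidIn (adversary-within f k [] 0 (ℕₚ.≤-reflexive (ℕₚ.+-comm k 1))) ,
    nested (suc i) ∷ [] , from∈ released , 1≤k ,
    subst (ρ * Len (run f k [] (adversary f k [] 0)) <_) (sym (Len-[0,h] (0≤c^ (suc i))))
      (≤-<-trans (*-monoˡ-≤-nonNeg ρ {{nonNegative 0≤ρ}} (Len-anchored-≤ _ (0≤c^ i) accepted≤))
                 (ρc^n<c^1+n i))

knownAlg-unbounded-ratio : ∀ k → 1 ≤ k → (alg : KnownAlg) (ρ : ℚ) → 1ℚ ℚ.≤ ρ →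
  ∃[ a ] ∃[ V ] (All (ValidIn a) V ×
    ∃[ U ] (U ⊆ V × length U ≤ k × ρ * ALGknown k alg a V < Len U))
knownAlg-unbounded-ratio k 1≤k alg ρ 1≤ρ = c^ suc k , V , V-defeats-alg
  where
  open Adversary ρ 1≤ρ
  f : List Interval → Interval → Bool
  f = alg (c^ suc k) (suc k)
  V : List Interval
  V = adversary f k [] 0
  V-defeats-alg : All (ValidIn (c^ suc k)) V ×
    ∃[ U ] (U ⊆ V × length U ≤ k × ρ * ALGknown k alg (c^ suc k) V < Len U)
  V-defeats-alg rewrite length-adversary f k [] 0 = adversary-wins k 1≤k f

unknownAlg-unbounded-ratio : ∀ k → 1 ≤ k → (alg : UnknownAlg) (ρ : ℚ) → 1ℚ ℚ.≤ ρ →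
  ∃[ a ] ∃[ V ] (All (ValidIn a) V ×
    ∃[ U ] (U ⊆ V × length U ≤ k × ρ * ALGunknown k alg a V < Len U))
unknownAlg-unbounded-ratio k 1≤k alg ρ 1≤ρ =
  c^ suc k , adversary (alg (c^ suc k)) k [] 0 , adversary-wins k 1≤k (alg (c^ suc k))
  where open Adversary ρ 1≤ρ

theorem1 : (k : ℕ) → 2 ≤ k →
    ((alg : KnownAlg) (ρ : ℚ) → 1ℚ ℚ.≤ ρ →
      ∃[ a ] ∃[ V ] (All (ValidIn a) V ×
        ∃[ U ] (U ⊆ V × length U ≤ k × ρ * ALGknown k alg a V < Len U)))
    ×
    ((alg : UnknownAlg) (ρ : ℚ) → 1ℚ ℚ.≤ ρ →
      ∃[ a ] ∃[ V ] (All (ValidIn a) V ×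
        ∃[ U ] (U ⊆ V × length U ≤ k × ρ * ALGunknown k alg a V < Len U)))
theorem1 k 2≤k = knownAlg-unbounded-ratio k 1≤k , unknownAlg-unbounded-ratio k 1≤k
  where
  1≤k : 1 ≤ k
  1≤k = ℕₚ.≤-trans (s≤s z≤n) 2≤k
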